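{- Let $0<1/m\ll\varepsilon\ll\lambda\ll d,\delta,1/r\le1$ where $r\ge2$ is an integer. Let $R$ be a graph on $r$ vertices and let $\mathcal{F}=(\mathcal{V},\mathscr{C},\mathbf{G})$ be a semi-super $R$-template with parameters $(m,\varepsilon,d,\delta)$. Then for all $ij\in E(R)$, the bipartite graph $T^\lambda_{\mathcal{F}}[V_i,V_j]$ is $(\varepsilon,d/2)$-half-superregular.
   Context: Hierarchy convention: $a\ll b$ means the statement holds whenever $a\le f(b)$ for an unspecified positive function $f$; constants chosen right to left. Bipartite collection regularity: for $(F_c:c\in\mathscr{D})$ bipartite with parts $W_1,W_2$, $d(W_1',W_2',\mathscr{D}')=\sum_{c\in\mathscr{D}'}e_{F_c}(W_1',W_2')/(|\mathscr{D}'||W_1'||W_2'|)$; $(\varepsilon,d)$-regular means $d(W_1,W_2,\mathscr{D})\ge d$ and $|d(W_1',W_2',\mathscr{D}')-d(W_1,W_2,\mathscr{D})|<\varepsilon$ for all $W_i'\subseteq W_i$ with $|W_i'|\ge\varepsilon|W_i|$, $\mathscr{D}'\subseteq\mathscr{D}$ with $|\mathscr{D}'|\ge\varepsilon|\mathscr{D}|$; $(\varepsilon,d)$-semi-superregular means $(\varepsilon,d)$-regular and $\sum_{c\in\mathscr{D}}d_{F_c}(v)\ge d|W_{3-i}||\mathscr{D}|$ for all $i\in[2]$, $v\in W_i$. Templates: $R$ on vertex set $[r]$; $\mathcal{V}=\{V_1,\dots,V_r\}$ disjoint, union $V$, $m\le|V_j|\le m/\delta$; $\mathscr{C}=\bigcup_{e\in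 E(R)}\mathscr{C}_e$, $|\mathscr{C}_e|\ge\delta m$; $\mathbf{G}$ a graph collection on $V$ with colour set $\mathscr{C}$, each $G_c$ the union over $e=ij$ with $c\in\mathscr{C}_e$ of bipartite graphs $G^e_c$ with parts $V_i,V_j$. It is a semi-super $R$-template with parameters $(m,\varepsilon,d,\delta)$ if each $(G^e_c:c\in\mathscr{C}_e)$ is $(\varepsilon,d)$-semi-superregular. Thick graph: $T^\lambda_{\mathcal{F}}$ is the simple graph on $V$ where $xy$ is an edge iff $x\in V_i$, $y\in V_j$, $ij\in E(R)$, and $xy\in E(G_c)$ for at least $\lambda|\mathscr{C}_{ij}|$ colours $c\in\mathscr{C}_{ij}$. A bipartite graph $T$ with parts $A,B$ is $(\varepsilon,d)$-half-superregular if $e_T(A',B')\ge d|A'||B'|$ for all $A'\subseteq A$, $B'\subseteq B$ with $|A'|\ge\varepsilon|A|$, $|B'|\ge\varepsilon|B|$, every $x\in A$ has at least $d|B|$ neighbours in $B$, and every $y\in B$ has at least $d|A|$ neighbours in $A$.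
   Formalization: The constants $d$, $\delta$, $\lambda$ and $\varepsilon$ of the hierarchy range over the rationals. -}

module Defs where

open import Data.Nat as ℕ using (ℕ; zero; suc)
open import Data.Fin using (Fin; zero; suc)
open import Data.Bool using (Bool; true; false; if_then_else_; _∧_)
open import Data.Integer using (+_)
open import Data.Rational as ℚ using (ℚ; _/_; _≤_; _<_; _*_; _-_; ∣_∣; _≤ᵇ_; 0ℚ)
open import Data.Product using (Σ; ∃; ∃-syntax; _×_; _,_)
open import Relation.Binary.PropositionalEquality using (_≡_)

toℚ : ℕ → ℚ
toℚ n = + n / 1

-- a / b as a rational, with the (irrelevant here) convention a / 0 = 0
frac : ℕ → ℕ → ℚ
frac a zero    = 0ℚ
frac a (suc b) = + a / suc b

-- finite sets as decidable subsets (Fin n → Bool); count = cardinality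
count : ∀ {n} → (Fin n → Bool) → ℕ
count {zero}  p = 0
count {suc n} p = (if p zero then 1 else 0) ℕ.+ count (λ i → p (suc i))

sumOver : ∀ {n} → (Fin n → Bool) → (Fin n → ℕ) → ℕ
sumOver {zero}  S f = 0
sumOver {suc n} S f = (if S zero then f zero else 0) ℕ.+ sumOver (λ i → S (suc i)) (λ i → f (suc i))

_⊆_ : ∀ {n} → (Fin n → Bool) → (Fin n → Bool) → Set
A ⊆ B = ∀ x → A x ≡ true → B x ≡ true

record Graph (n : ℕ) : Set where
  field
    adj   : Fin n → Fin n → Bool
    sym   : ∀ x y → adj x y ≡ adj y x
    irrefl : ∀ x → adj x x ≡ false
open Graph public

eCount : ∀ {n} → (Fin n → Fin n → Bool) → (Fin n → Bool) → (Fin n → Bool) → ℕ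
eCount F A B = sumOver A (λ x → count (λ y → B y ∧ F x y))

-- bipartite collections (F_c : c ∈ D) with parts W₁, W₂; F_c given by
-- its adjacency (only edges between W₁ and W₂ are counted)

density : ∀ {n k} → (Fin k → Fin n → Fin n → Bool) →
          (Fin n → Bool) → (Fin n → Bool) → (Fin k → Bool) → ℚ
density F W₁ W₂ D =
  frac (sumOver D (λ c → eCount (F c) W₁ W₂)) (count D ℕ.* count W₁ ℕ.* count W₂)

IsRegular : ∀ {n k} → ℚ → ℚ → (Fin k → Fin n → Fin n → Bool) →
            (Fin n → Bool) → (Fin n → Bool) → (Fin k → Bool) → Set
IsRegular ε d F W₁ W₂ D =
  d ≤ density F W₁ W₂ D ×
  (∀ W₁' W₂' D' → W₁' ⊆ W₁ → W₂' ⊆ W₂ → D' ⊆ D →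
     ε * toℚ (count W₁) ≤ toℚ (count W₁') →
     ε * toℚ (count W₂) ≤ toℚ (count W₂') →
     ε * toℚ (count D) ≤ toℚ (count D') →
     ∣ density F W₁' W₂' D' - density F W₁ W₂ D ∣ < ε)

IsSemiSuperregular : ∀ {n k} → ℚ → ℚ → (Fin k → Fin n → Fin n → Bool) →
            (Fin n → Bool) → (Fin n → Bool) → (Fin k → Bool) → Set
IsSemiSuperregular ε d F W₁ W₂ D =
  IsRegular ε d F W₁ W₂ D ×
  (∀ v → W₁ v ≡ true →
     d * toℚ (count W₂) * toℚ (count D) ≤ toℚ (sumOver D (λ c → count (λ y → W₂ y ∧ F c v y)))) ×
  (∀ v → W₂ v ≡ true →
     d * toℚ (count W₁) * toℚ (count D) ≤ toℚ (sumOver D (λ c → count (λ y → W₁ y ∧ F c v y))))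

_≟F_ : ∀ {r} → Fin r → Fin r → Bool
zero  ≟F zero  = true
zero  ≟F suc _ = false
suc _ ≟F zero  = false
suc i ≟F suc j = i ≟F j

-- 𝓕 = (𝒱, 𝒞, 𝐆) over R on [r]:
--  vertex set V = Fin n, partitioned as V_i = {x | part x = i};
--  colour set 𝒞 = Fin k, with 𝒞_e given by inC i j (symmetric in i j);
--  G_c a graph on V whose every edge lies between V_i and V_j with
--  ij ∈ E(R) and c ∈ 𝒞_ij (so G_c = ⋃_{e ∋ c} G^e_c, G^e_c = G_c[V_i,V_j]).
record Template {r : ℕ} (R : Graph r) : Set where
  field
    n     : ℕ
    part  : Fin n → Fin r
    k     : ℕ
    inC   : Fin r → Fin r → Fin k → Bool
    inC-sym  : ∀ i j c → inC i j c ≡ inC j i c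
    inC-edge : ∀ i j c → inC i j c ≡ true → adj R i j ≡ true
    inC-cover : ∀ c → ∃[ i ] ∃[ j ] (inC i j c ≡ true)
    G     : Fin k → Graph n
    G-edge : ∀ c x y → adj (G c) x y ≡ true →
             (adj R (part x) (part y) ≡ true) × (inC (part x) (part y) c ≡ true)
open Template public

Vpart : ∀ {r} {R : Graph r} → (𝓕 : Template R) → Fin r → Fin (n 𝓕) → Bool
Vpart 𝓕 i x = part 𝓕 x ≟F i

Cedge : ∀ {r} {R : Graph r} → (𝓕 : Template R) → Fin r → Fin r → Fin (k 𝓕) → Bool
Cedge 𝓕 i j = inC 𝓕 i j

IsSemiSuperTemplate : ∀ {r} (R : Graph r) → Template R → ℕ → ℚ → ℚ → ℚ → Set
IsSemiSuperTemplate R 𝓕 m ε d δ =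
  (∀ i → toℚ m ≤ toℚ (count (Vpart 𝓕 i)) × δ * toℚ (count (Vpart 𝓕 i)) ≤ toℚ m) ×
  (∀ i j → adj R i j ≡ true →
     δ * toℚ m ≤ toℚ (count (Cedge 𝓕 i j)) ×
     IsSemiSuperregular ε d (λ c → adj (G 𝓕 c)) (Vpart 𝓕 i) (Vpart 𝓕 j) (Cedge 𝓕 i j))

thick : ∀ {r} {R : Graph r} → ℚ → (𝓕 : Template R) → Fin (n 𝓕) → Fin (n 𝓕) → Bool
thick {R = R} λ' 𝓕 x y =
  adj R (part 𝓕 x) (part 𝓕 y) ∧
  (λ' * toℚ (count (Cedge 𝓕 (part 𝓕 x) (part 𝓕 y)))
     ≤ᵇ toℚ (count (λ c → Cedge 𝓕 (part 𝓕 x) (part 𝓕 y) c ∧ adj (G 𝓕 c) x y)))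

IsHalfSuperregular : ∀ {n} → ℚ → ℚ → (Fin n → Fin n → Bool) →
                     (Fin n → Bool) → (Fin n → Bool) → Set
IsHalfSuperregular ε d T A B =
  (∀ A' B' → A' ⊆ A → B' ⊆ B →
     ε * toℚ (count A) ≤ toℚ (count A') →
     ε * toℚ (count B) ≤ toℚ (count B') →
     d * toℚ (count A') * toℚ (count B') ≤ toℚ (eCount T A' B')) ×
  (∀ x → A x ≡ true → d * toℚ (count B) ≤ toℚ (count (λ y → B y ∧ T x y))) ×
  (∀ y → B y ≡ true → d * toℚ (count A) ≤ toℚ (count (λ x → A x ∧ T y x)))

-- Fix ij ∈ E(R) and write C = 𝒞_ij. For x ∈ V_i, count the pairs (c, y) with c ∈ C, y ∈ V_j and
-- xy ∈ G_c in two ways. Semi-superregularity makes this at least d|V_j||C|; grouped by y, a thick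
-- pair xy contributes at most |C| and any other pair fewer than λ|C|, so the total is at most
-- |C| deg_T(x) + λ|C||V_j|, giving deg_T(x) ≥ (d - λ)|V_j|. Similarly, for large A ⊆ V_i, B ⊆ V_j,
-- regularity with 𝒟' = C gives Σ_c e_{G_c}(A,B) ≥ (d - ε)|C||A||B|, while the same grouping bounds
-- it by |C| e_T(A,B) + λ|C||A||B|, so e_T(A,B) ≥ (d - ε - λ)|A||B|. Taking ε, λ ≤ d/4 gives d/2.

module Submission where

open import Defs hiding (sym)
open import Data.Nat using (ℕ)
open import Data.Fin using (Fin)
open import Data.Product using (Σ; ∃; ∃-syntax; _×_)
open import Data.Rational using (ℚ; _≤_; _<_; _*_; 0ℚ; 1ℚ; ½)
open import Relation.Binary.PropositionalEquality using (_≡_)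
open import Data.Bool using (true)

open import Algebra.Properties.CommutativeSemigroup using (interchange)
open import Data.Bool using (Bool; false; if_then_else_; _∧_; T)
open import Data.Empty using (⊥-elim)
open import Data.Fin using (zero; suc)
open import Data.Integer as ℤ using (+_)
import Data.Integer.Properties as ℤₚ
open import Data.Nat as ℕ using (zero; suc)
import Data.Nat.Properties as ℕₚ
open import Data.Product using (_,_; proj₁; proj₂)
open import Data.Sum using (inj₁; inj₂)
open import Data.Rational using (_+_; _-_; -_; ∣_∣; _≤ᵇ_; toℚᵘ; positive; nonNegative)
open import Data.Rational.Properties
open import Data.Rational.Solver using (module +-*-Solver)
import Data.Rational.Unnormalised as ℚᵘ
import Data.Rational.Unnormalised.Properties as ℚᵘ
open import Relation.Binary.PropositionalEquality
  using (refl; sym; trans; cong; cong₂; subst; subst₂; module ≡-Reasoning)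

-- Arithmetic on ℚ normalises; the homomorphism facts for ℕ → ℚ are checked in ℚᵘ instead.
toℚᵘ-toℚ : ∀ n → toℚᵘ (toℚ n) ℚᵘ.≃ ℚᵘ.mkℚᵘ (+ n) 0
toℚᵘ-toℚ n = toℚᵘ-fromℚᵘ (ℚᵘ.mkℚᵘ (+ n) 0)

toℚ-+ : ∀ a b → toℚ (a ℕ.+ b) ≡ toℚ a + toℚ b
toℚ-+ a b = toℚᵘ-injective (begin
  toℚᵘ (toℚ (a ℕ.+ b))                      ≈⟨ toℚᵘ-toℚ (a ℕ.+ b) ⟩
  ℚᵘ.mkℚᵘ (+ (a ℕ.+ b)) 0                   ≈⟨ ℚᵘ.≃-reflexive (cong (λ z → ℚᵘ.mkℚᵘ z 0) numerators) ⟩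
  ℚᵘ.mkℚᵘ (+ a) 0 ℚᵘ.+ ℚᵘ.mkℚᵘ (+ b) 0      ≈⟨ ℚᵘ.+-cong (toℚᵘ-toℚ a) (toℚᵘ-toℚ b) ⟨
  toℚᵘ (toℚ a) ℚᵘ.+ toℚᵘ (toℚ b)            ≈⟨ toℚᵘ-homo-+ (toℚ a) (toℚ b) ⟨
  toℚᵘ (toℚ a + toℚ b)                      ∎)
  where
  open ℚᵘ.≃-Reasoning
  numerators : + (a ℕ.+ b) ≡ + a ℤ.* + 1 ℤ.+ + b ℤ.* + 1
  numerators = sym (cong₂ ℤ._+_ (ℤₚ.*-identityʳ (+ a)) (ℤₚ.*-identityʳ (+ b)))

toℚ-* : ∀ a b → toℚ (a ℕ.* b) ≡ toℚ a * toℚ b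
toℚ-* a b = toℚᵘ-injective (begin
  toℚᵘ (toℚ (a ℕ.* b))                      ≈⟨ toℚᵘ-toℚ (a ℕ.* b) ⟩
  ℚᵘ.mkℚᵘ (+ (a ℕ.* b)) 0                   ≈⟨ ℚᵘ.≃-reflexive (cong (λ z → ℚᵘ.mkℚᵘ z 0) (ℤₚ.pos-* a b)) ⟩
  ℚᵘ.mkℚᵘ (+ a) 0 ℚᵘ.* ℚᵘ.mkℚᵘ (+ b) 0      ≈⟨ ℚᵘ.*-cong (toℚᵘ-toℚ a) (toℚᵘ-toℚ b) ⟨
  toℚᵘ (toℚ a) ℚᵘ.* toℚᵘ (toℚ b)            ≈⟨ toℚᵘ-homo-* (toℚ a) (toℚ b) ⟨
  toℚᵘ (toℚ a * toℚ b)                      ∎)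
  where open ℚᵘ.≃-Reasoning

frac-*-cancel : ∀ a b → frac a (suc b) * toℚ (suc b) ≡ toℚ a
frac-*-cancel a b = toℚᵘ-injective (begin
  toℚᵘ (frac a (suc b) * toℚ (suc b))                 ≈⟨ toℚᵘ-homo-* (frac a (suc b)) (toℚ (suc b)) ⟩
  toℚᵘ (frac a (suc b)) ℚᵘ.* toℚᵘ (toℚ (suc b))
    ≈⟨ ℚᵘ.*-cong (toℚᵘ-fromℚᵘ (ℚᵘ.mkℚᵘ (+ a) b)) (toℚᵘ-toℚ (suc b)) ⟩
  ℚᵘ.mkℚᵘ (+ a) b ℚᵘ.* ℚᵘ.mkℚᵘ (+ suc b) 0            ≈⟨ ℚᵘ.*≡* cross ⟩
  ℚᵘ.mkℚᵘ (+ a) 0                                     ≈⟨ toℚᵘ-toℚ a ⟨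
  toℚᵘ (toℚ a)                                        ∎)
  where
  open ℚᵘ.≃-Reasoning
  cross : (+ a ℤ.* + suc b) ℤ.* + 1 ≡ + a ℤ.* + (suc b ℕ.* 1)
  cross = trans (ℤₚ.*-identityʳ _) (cong (λ k → + a ℤ.* + k) (sym (ℕₚ.*-identityʳ (suc b))))

toℚ-nonNeg : ∀ n → 0ℚ ≤ toℚ n
toℚ-nonNeg n = nonNegative⁻¹ _ {{normalize-nonNeg n 1}}

toℚ-pos : ∀ {n} → 0 ℕ.< n → 0ℚ < toℚ n
toℚ-pos {suc n} _ = positive⁻¹ _ {{normalize-pos (suc n) 1}}

toℚ-mono-≤ : ∀ {a b} → a ℕ.≤ b → toℚ a ≤ toℚ b
toℚ-mono-≤ {a} a≤b with ℕₚ.m≤n⇒∃[o]m+o≡n a≤b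
... | o , refl = subst (_≤ toℚ (a ℕ.+ o)) (+-identityʳ (toℚ a))
  (subst (toℚ a + 0ℚ ≤_) (sym (toℚ-+ a o)) (+-monoʳ-≤ (toℚ a) (toℚ-nonNeg o)))

frac-lower-bound : ∀ q a {b} → 0ℚ < toℚ b → q ≤ frac a b → q * toℚ b ≤ toℚ a
frac-lower-bound q a {zero}  0<0 _     = ⊥-elim (<-irrefl refl 0<0)
frac-lower-bound q a {suc b} _   q≤a/b =
  subst (q * toℚ (suc b) ≤_) (frac-*-cancel a b)
    (*-monoʳ-≤-nonNeg (toℚ (suc b)) {{nonNegative (toℚ-nonNeg (suc b))}} q≤a/b)

pos*pos : ∀ {p q} → 0ℚ < p → 0ℚ < q → 0ℚ < p * q
pos*pos {p} {q} 0<p 0<q = positive⁻¹ _ {{pos*pos⇒pos p {{positive 0<p}} q {{positive 0<q}}}}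

nonNeg*nonNeg : ∀ {p q} → 0ℚ ≤ p → 0ℚ ≤ q → 0ℚ ≤ p * q
nonNeg*nonNeg {p} {q} 0≤p 0≤q =
  nonNegative⁻¹ _ {{nonNeg*nonNeg⇒nonNeg p {{nonNegative 0≤p}} q {{nonNegative 0≤q}}}}

≤-by-difference : ∀ {p q} r → q - p ≡ r → 0ℚ ≤ r → p ≤ q
≤-by-difference {p} {q} r q-p≡r 0≤r =
  subst₂ _≤_ (+-identityʳ p) p+[q-p]≡q (+-monoʳ-≤ p (subst (0ℚ ≤_) (sym q-p≡r) 0≤r))
  where
  open +-*-Solver
  p+[q-p]≡q : p + (q - p) ≡ q
  p+[q-p]≡q = solve 2 (λ p q → p :+ (q :- p) := q) refl p q

difference-nonNeg : ∀ {p q} → p ≤ q → 0ℚ ≤ q - p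
difference-nonNeg {p} {q} p≤q = subst (_≤ q - p) (+-inverseʳ p) (+-monoˡ-≤ (- p) p≤q)

-p≤∣p∣ : ∀ p → - p ≤ ∣ p ∣
-p≤∣p∣ p with ∣p∣≡p∨∣p∣≡-p p
... | inj₁ ∣p∣≡p  = ≤-trans (neg-antimono-≤ (∣p∣≡p⇒0≤p ∣p∣≡p)) (0≤∣p∣ p)
... | inj₂ ∣p∣≡-p = ≤-reflexive (sym ∣p∣≡-p)

close⇒lower-bound : ∀ {p q ε d} → ∣ p - q ∣ < ε → d ≤ q → d - ε ≤ p
close⇒lower-bound {p} {q} {ε} {d} ∣p-q∣<ε d≤q =
  ≤-by-difference ((ε - (- (p - q))) + (q - d))
    (solve 4 (λ p q ε d → p :- (d :- ε) := (ε :- (:- (p :- q))) :+ (q :- d)) refl p q ε d)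
    (+-mono-≤ (difference-nonNeg (<⇒≤ (≤-<-trans (-p≤∣p∣ (p - q)) ∣p-q∣<ε))) (difference-nonNeg d≤q))
  where open +-*-Solver

p≤1⇒p*q≤q : ∀ {ε} x → 0ℚ ≤ x → ε ≤ 1ℚ → ε * x ≤ x
p≤1⇒p*q≤q {ε} x 0≤x ε≤1 = subst (ε * x ≤_) (*-identityˡ x) (*-monoʳ-≤-nonNeg x {{nonNegative 0≤x}} ε≤1)

indicator : Bool → ℕ
indicator b = if b then 1 else 0

count-cong : ∀ {n} {p q : Fin n → Bool} → (∀ x → p x ≡ q x) → count p ≡ count q
count-cong {zero}  p≗q = refl
count-cong {suc n} p≗q = cong₂ ℕ._+_ (cong indicator (p≗q zero)) (count-cong (λ x → p≗q (suc x)))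

count-∧-≤ : ∀ {n} (D P : Fin n → Bool) → count (λ c → D c ∧ P c) ℕ.≤ count D
count-∧-≤ {zero}  D P = ℕ.z≤n
count-∧-≤ {suc n} D P with D zero | P zero
... | true  | true  = ℕ.s≤s (count-∧-≤ (λ i → D (suc i)) (λ i → P (suc i)))
... | true  | false = ℕₚ.m≤n⇒m≤1+n (count-∧-≤ (λ i → D (suc i)) (λ i → P (suc i)))
... | false | _     = count-∧-≤ (λ i → D (suc i)) (λ i → P (suc i))

count-∧ : ∀ {n} (B P : Fin n → Bool) → count (λ y → B y ∧ P y) ≡ sumOver B (λ y → indicator (P y))
count-∧ {zero}  B P = refl
count-∧ {suc n} B P with B zero
... | true  = cong (indicator (P zero) ℕ.+_) (count-∧ (λ i → B (suc i)) (λ i → P (suc i)))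
... | false = count-∧ (λ i → B (suc i)) (λ i → P (suc i))

sumOver-cong : ∀ {n} (S : Fin n → Bool) {f g : Fin n → ℕ} → (∀ x → f x ≡ g x) → sumOver S f ≡ sumOver S g
sumOver-cong {zero}  S f≗g = refl
sumOver-cong {suc n} S f≗g =
  cong₂ ℕ._+_ (cong (λ v → if S zero then v else 0) (f≗g zero)) (sumOver-cong (λ i → S (suc i)) (λ x → f≗g (suc x)))

sumOver-zero : ∀ {n} (S : Fin n → Bool) → sumOver S (λ _ → 0) ≡ 0
sumOver-zero {zero}  S = refl
sumOver-zero {suc n} S with S zero
... | true  = sumOver-zero (λ i → S (suc i))
... | false = sumOver-zero (λ i → S (suc i))

sumOver-+ : ∀ {n} (S : Fin n → Bool) (f g : Fin n → ℕ) →
  sumOver S (λ x → f x ℕ.+ g x) ≡ sumOver S f ℕ.+ sumOver S g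
sumOver-+ {zero}  S f g = refl
sumOver-+ {suc n} S f g with S zero
... | true  = trans (cong (f zero ℕ.+ g zero ℕ.+_) (sumOver-+ (λ i → S (suc i)) _ _))
                    (interchange ℕₚ.+-commutativeSemigroup (f zero) (g zero) _ _)
... | false = sumOver-+ (λ i → S (suc i)) _ _

sumOver-comm : ∀ {n k} (D : Fin k → Bool) (A : Fin n → Bool) (h : Fin k → Fin n → ℕ) →
  sumOver D (λ c → sumOver A (h c)) ≡ sumOver A (λ x → sumOver D (λ c → h c x))
sumOver-comm {k = zero}  D A h = sym (sumOver-zero A)
sumOver-comm {k = suc k} D A h = begin
  (if D zero then sumOver A (h zero) else 0) ℕ.+ sumOver D′ (λ c → sumOver A (h (suc c)))
    ≡⟨ cong₂ ℕ._+_ (head (D zero)) (sumOver-comm D′ A (λ c → h (suc c))) ⟩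
  sumOver A (λ x → if D zero then h zero x else 0) ℕ.+ sumOver A (λ x → sumOver D′ (λ c → h (suc c) x))
    ≡⟨ sumOver-+ A _ _ ⟨
  sumOver A (λ x → sumOver D (λ c → h c x)) ∎
  where
  open ≡-Reasoning
  D′ : Fin k → Bool
  D′ c = D (suc c)
  head : ∀ b → (if b then sumOver A (h zero) else 0) ≡ sumOver A (λ x → if b then h zero x else 0)
  head true  = refl
  head false = sym (sumOver-zero A)

double-count : ∀ {n k} (D : Fin k → Bool) (B : Fin n → Bool) (F : Fin k → Fin n → Bool) →
  sumOver D (λ c → count (λ y → B y ∧ F c y)) ≡ sumOver B (λ y → count (λ c → D c ∧ F c y))
double-count D B F = begin
  sumOver D (λ c → count (λ y → B y ∧ F c y))               ≡⟨ sumOver-cong D (λ c → count-∧ B (F c)) ⟩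
  sumOver D (λ c → sumOver B (λ y → indicator (F c y)))     ≡⟨ sumOver-comm D B _ ⟩
  sumOver B (λ y → sumOver D (λ c → indicator (F c y)))     ≡⟨ sumOver-cong B (λ y → count-∧ D (λ c → F c y)) ⟨
  sumOver B (λ y → count (λ c → D c ∧ F c y))               ∎
  where open ≡-Reasoning

toℚ-sumOver-≤ : ∀ {n} (B : Fin n → Bool) (f g : Fin n → ℕ) (a b : ℚ) →
  (∀ y → B y ≡ true → toℚ (f y) ≤ a * (toℚ (g y) + b)) →
  toℚ (sumOver B f) ≤ a * (toℚ (sumOver B g) + b * toℚ (count B))
toℚ-sumOver-≤ {zero} B f g a b _ = ≤-reflexive (solve 2 (λ a b → con 0ℚ := a :* (con 0ℚ :+ b :* con 0ℚ)) refl a b)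
  where open +-*-Solver
toℚ-sumOver-≤ {suc n} B f g a b f≤ with B zero in B₀
... | false = toℚ-sumOver-≤ (λ i → B (suc i)) (λ i → f (suc i)) (λ i → g (suc i)) a b (λ y → f≤ (suc y))
... | true  = begin
  toℚ (f zero ℕ.+ Σf)                                   ≡⟨ toℚ-+ (f zero) Σf ⟩
  toℚ (f zero) + toℚ Σf                                 ≤⟨ +-mono-≤ (f≤ zero B₀) rest ⟩
  a * (toℚ (g zero) + b) + a * (toℚ Σg + b * toℚ |B|)   ≡⟨ regroup ⟩
  a * ((toℚ (g zero) + toℚ Σg) + b * (1ℚ + toℚ |B|))
    ≡⟨ cong₂ (λ s t → a * (s + b * t)) (toℚ-+ (g zero) Σg) (toℚ-+ 1 |B|) ⟨
  a * (toℚ (g zero ℕ.+ Σg) + b * toℚ (1 ℕ.+ |B|))       ∎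
  where
  open ≤-Reasoning
  open +-*-Solver
  B′ : Fin n → Bool
  B′ i = B (suc i)
  Σf Σg |B| : ℕ
  Σf = sumOver B′ (λ i → f (suc i))
  Σg = sumOver B′ (λ i → g (suc i))
  |B| = count B′
  rest : toℚ Σf ≤ a * (toℚ Σg + b * toℚ |B|)
  rest = toℚ-sumOver-≤ B′ (λ i → f (suc i)) (λ i → g (suc i)) a b (λ y → f≤ (suc y))
  regroup : a * (toℚ (g zero) + b) + a * (toℚ Σg + b * toℚ |B|) ≡ a * ((toℚ (g zero) + toℚ Σg) + b * (1ℚ + toℚ |B|))
  regroup = solve 5 (λ a b x y z → a :* (x :+ b) :+ a :* (y :+ b :* z) := a :* ((x :+ y) :+ b :* (con 1ℚ :+ z)))
                  refl a b (toℚ (g zero)) (toℚ Σg) (toℚ |B|)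

regular⇒colourEdges-≥ : ∀ {n k ε d} {F : Fin k → Fin n → Fin n → Bool} {W₁ W₂ W₁′ W₂′ : Fin n → Bool}
  {D : Fin k → Bool} → IsRegular ε d F W₁ W₂ D → 0ℚ < ε → ε ≤ 1ℚ →
  0ℚ < toℚ (count D) → 0ℚ < toℚ (count W₁) → 0ℚ < toℚ (count W₂) → W₁′ ⊆ W₁ → W₂′ ⊆ W₂ →
  ε * toℚ (count W₁) ≤ toℚ (count W₁′) → ε * toℚ (count W₂) ≤ toℚ (count W₂′) →
  (d - ε) * (toℚ (count D) * toℚ (count W₁′) * toℚ (count W₂′))
    ≤ toℚ (sumOver D (λ c → eCount (F c) W₁′ W₂′))
regular⇒colourEdges-≥ {ε = ε} {d} {F} {W₁′ = W₁′} {W₂′} {D} (d≤density , regular) 0<ε ε≤1 0<|D| 0<|W₁| 0<|W₂|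
                      W₁′⊆W₁ W₂′⊆W₂ big₁ big₂ = begin
  (d - ε) * (toℚ (count D) * toℚ (count W₁′) * toℚ (count W₂′)) ≡⟨ cong ((d - ε) *_) |D||W₁′||W₂′| ⟨
  (d - ε) * toℚ N                                                ≤⟨ frac-lower-bound (d - ε) S {N} 0<N d-ε≤density′ ⟩
  toℚ S                                                          ∎
  where
  open ≤-Reasoning
  N S : ℕ
  N = count D ℕ.* count W₁′ ℕ.* count W₂′
  S = sumOver D (λ c → eCount (F c) W₁′ W₂′)
  |D||W₁′||W₂′| : toℚ N ≡ toℚ (count D) * toℚ (count W₁′) * toℚ (count W₂′)
  |D||W₁′||W₂′| = trans (toℚ-* (count D ℕ.* count W₁′) (count W₂′))
                        (cong (_* toℚ (count W₂′)) (toℚ-* (count D) (count W₁′)))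
  nonEmpty : ∀ {w w′} → ε * w ≤ w′ → 0ℚ < w → 0ℚ < w′
  nonEmpty εw≤w′ 0<w = <-≤-trans (pos*pos 0<ε 0<w) εw≤w′
  0<N : 0ℚ < toℚ N
  0<N = subst (0ℚ <_) (sym |D||W₁′||W₂′|) (pos*pos (pos*pos 0<|D| (nonEmpty big₁ 0<|W₁|)) (nonEmpty big₂ 0<|W₂|))
  d-ε≤density′ : d - ε ≤ frac S N
  d-ε≤density′ = close⇒lower-bound
    (regular W₁′ W₂′ D W₁′⊆W₁ W₂′⊆W₂ (λ _ c∈D → c∈D) big₁ big₂ (p≤1⇒p*q≤q _ (toℚ-nonNeg (count D)) ε≤1))
    d≤density

isThick : ∀ {n k} → ℚ → (Fin k → Bool) → (Fin k → Fin n → Fin n → Bool) → Fin n → Fin n → Bool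
isThick λ′ C F x y = λ′ * toℚ (count C) ≤ᵇ toℚ (count (λ c → C c ∧ F c x y))

isThick-cong : ∀ {n k} λ′ {C C′ : Fin k → Bool} (F : Fin k → Fin n → Fin n → Bool) x y →
  (∀ c → C c ≡ C′ c) → isThick λ′ C F x y ≡ isThick λ′ C′ F x y
isThick-cong λ′ F x y C≗C′ =
  cong₂ (λ a b → λ′ * toℚ a ≤ᵇ toℚ b) (count-cong C≗C′) (count-cong (λ c → cong (_∧ F c x y) (C≗C′ c)))

≤-threshold : ∀ {λ′ q u} → 0ℚ ≤ λ′ → 0ℚ ≤ q → q ≤ u → q ≤ u * (toℚ (indicator (λ′ * u ≤ᵇ q)) + λ′)
≤-threshold {λ′} {q} {u} 0≤λ 0≤q q≤u with λ′ * u ≤ᵇ q in above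
... | true  = begin
  q                  ≤⟨ q≤u ⟩
  u                  ≡⟨ +-identityʳ u ⟨
  u + 0ℚ             ≤⟨ +-monoʳ-≤ u (nonNeg*nonNeg 0≤λ (≤-trans 0≤q q≤u)) ⟩
  u + λ′ * u         ≡⟨ solve 2 (λ u l → u :+ l :* u := u :* (con 1ℚ :+ l)) refl u λ′ ⟩
  u * (1ℚ + λ′)      ∎
  where
  open ≤-Reasoning
  open +-*-Solver
... | false = begin
  q                  ≤⟨ <⇒≤ (≰⇒> (λ λu≤q → subst T above (≤⇒≤ᵇ λu≤q))) ⟩
  λ′ * u             ≡⟨ solve 2 (λ u l → l :* u := u :* (con 0ℚ :+ l)) refl u λ′ ⟩
  u * (0ℚ + λ′)      ∎
  where
  open ≤-Reasoning
  open +-*-Solver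

record ThickOn {n k} (λ′ : ℚ) (C : Fin k → Bool) (F : Fin k → Fin n → Fin n → Bool)
               (T : Fin n → Fin n → Bool) (A B : Fin n → Bool) : Set where
  constructor thickOn
  field
    isThick-≡ : ∀ {x y} → A x ≡ true → B y ≡ true → T x y ≡ isThick λ′ C F x y

ThickOn-⊆ : ∀ {n k λ′ C F T} {A B A′ B′ : Fin n → Bool} → ThickOn {n} {k} λ′ C F T A B →
  A′ ⊆ A → B′ ⊆ B → ThickOn λ′ C F T A′ B′
ThickOn-⊆ (thickOn T-thick) A′⊆A B′⊆B =
  thickOn λ {x} {y} x∈A′ y∈B′ → T-thick (A′⊆A x x∈A′) (B′⊆B y y∈B′)

module _ {n k} {λ′ : ℚ} {C : Fin k → Bool} {F : Fin k → Fin n → Fin n → Bool}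
         {T : Fin n → Fin n → Bool} {A B : Fin n → Bool}
         (0≤λ : 0ℚ ≤ λ′) (T-thick : ThickOn λ′ C F T A B) where

  colourDegree-≤ : ∀ {x} → A x ≡ true →
    toℚ (sumOver C (λ c → count (λ y → B y ∧ F c x y)))
      ≤ toℚ (count C) * (toℚ (count (λ y → B y ∧ T x y)) + λ′ * toℚ (count B))
  colourDegree-≤ {x} x∈A = begin
    toℚ (sumOver C (λ c → count (λ y → B y ∧ F c x y)))
      ≡⟨ cong toℚ (double-count C B (λ c y → F c x y)) ⟩
    toℚ (sumOver B (λ y → count (λ c → C c ∧ F c x y)))
      ≤⟨ toℚ-sumOver-≤ B (λ y → count (λ c → C c ∧ F c x y)) (λ y → indicator (T x y))
                       (toℚ (count C)) λ′ perVertex ⟩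
    toℚ (count C) * (toℚ (sumOver B (λ y → indicator (T x y))) + λ′ * toℚ (count B))
      ≡⟨ cong (λ s → toℚ (count C) * (toℚ s + λ′ * toℚ (count B))) (count-∧ B (T x)) ⟨
    toℚ (count C) * (toℚ (count (λ y → B y ∧ T x y)) + λ′ * toℚ (count B)) ∎
    where
    open ≤-Reasoning
    perVertex : ∀ y → B y ≡ true →
      toℚ (count (λ c → C c ∧ F c x y)) ≤ toℚ (count C) * (toℚ (indicator (T x y)) + λ′)
    perVertex y y∈B = subst (λ b → toℚ (count (λ c → C c ∧ F c x y)) ≤ toℚ (count C) * (toℚ (indicator b) + λ′))
      (sym (ThickOn.isThick-≡ T-thick x∈A y∈B))
      (≤-threshold 0≤λ (toℚ-nonNeg (count (λ c → C c ∧ F c x y))) (toℚ-mono-≤ (count-∧-≤ C (λ c → F c x y))))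

  colourEdges-≤ :
    toℚ (sumOver C (λ c → eCount (F c) A B))
      ≤ toℚ (count C) * (toℚ (eCount T A B) + λ′ * toℚ (count B) * toℚ (count A))
  colourEdges-≤ = begin
    toℚ (sumOver C (λ c → eCount (F c) A B))
      ≡⟨ cong toℚ (sumOver-comm C A (λ c x → count (λ y → B y ∧ F c x y))) ⟩
    toℚ (sumOver A (λ x → sumOver C (λ c → count (λ y → B y ∧ F c x y))))
      ≤⟨ toℚ-sumOver-≤ A (λ x → sumOver C (λ c → count (λ y → B y ∧ F c x y))) (λ x → count (λ y → B y ∧ T x y))
                       (toℚ (count C)) (λ′ * toℚ (count B)) (λ x x∈A → colourDegree-≤ x∈A) ⟩
    toℚ (count C) * (toℚ (eCount T A B) + λ′ * toℚ (count B) * toℚ (count A)) ∎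
    where open ≤-Reasoning

quarter : ℚ → ℚ
quarter d = ½ * (½ * d)

quarter-nonNeg : ∀ {d} → 0ℚ ≤ d → 0ℚ ≤ quarter d
quarter-nonNeg 0≤d = nonNeg*nonNeg (<⇒≤ (positive⁻¹ ½)) (nonNeg*nonNeg (<⇒≤ (positive⁻¹ ½)) 0≤d)

quarter-≤ : ∀ {d} → 0ℚ ≤ d → quarter d ≤ d
quarter-≤ {d} 0≤d = ≤-by-difference (½ * d + quarter d)
  (solve 1 (λ d → d :- con ½ :* (con ½ :* d) := con ½ :* d :+ con ½ :* (con ½ :* d)) refl d)
  (+-mono-≤ (nonNeg*nonNeg (<⇒≤ (positive⁻¹ ½)) 0≤d) (quarter-nonNeg 0≤d))
  where open +-*-Solver

degree-loss⇒half : ∀ {d λ′ v c t} → 0ℚ < c → 0ℚ ≤ v → 0ℚ ≤ d → λ′ ≤ quarter d →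
  d * v * c ≤ c * (t + λ′ * v) → ½ * d * v ≤ t
degree-loss⇒half {d} {λ′} {v} {c} {t} 0<c 0≤v 0≤d λ≤d/4 dvc≤ =
  *-cancelʳ-≤-pos c {{positive 0<c}} (≤-by-difference _ slack
    (+-mono-≤ (difference-nonNeg dvc≤)
              (nonNeg*nonNeg (+-mono-≤ (difference-nonNeg λ≤d/4) (quarter-nonNeg 0≤d))
                             (nonNeg*nonNeg (<⇒≤ 0<c) 0≤v))))
  where
  open +-*-Solver
  slack : t * c - ½ * d * v * c ≡ (c * (t + λ′ * v) - d * v * c) + ((quarter d - λ′) + quarter d) * (c * v)
  slack = solve 5 (λ d l v c t → t :* c :- con ½ :* d :* v :* c
                    := (c :* (t :+ l :* v) :- d :* v :* c) :+ ((con ½ :* (con ½ :* d) :- l) :+ con ½ :* (con ½ :* d)) :* (c :* v))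
                  refl d λ′ v c t

density-loss⇒half : ∀ {d ε λ′ a b c e} → 0ℚ < c → 0ℚ ≤ a → 0ℚ ≤ b → ε ≤ quarter d → λ′ ≤ quarter d →
  (d - ε) * (c * a * b) ≤ c * (e + λ′ * b * a) → ½ * d * a * b ≤ e
density-loss⇒half {d} {ε} {λ′} {a} {b} {c} {e} 0<c 0≤a 0≤b ε≤d/4 λ≤d/4 dcab≤ =
  *-cancelʳ-≤-pos c {{positive 0<c}} (≤-by-difference _ slack
    (+-mono-≤ (difference-nonNeg dcab≤)
              (nonNeg*nonNeg (+-mono-≤ (difference-nonNeg λ≤d/4) (difference-nonNeg ε≤d/4))
                             (nonNeg*nonNeg (nonNeg*nonNeg (<⇒≤ 0<c) 0≤a) 0≤b))))
  where
  open +-*-Solver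
  slack : e * c - ½ * d * a * b * c
        ≡ (c * (e + λ′ * b * a) - (d - ε) * (c * a * b)) + ((quarter d - λ′) + (quarter d - ε)) * (c * a * b)
  slack = solve 7 (λ d ε l a b c e → e :* c :- con ½ :* d :* a :* b :* c
                    := (c :* (e :+ l :* b :* a) :- (d :- ε) :* (c :* a :* b))
                       :+ ((con ½ :* (con ½ :* d) :- l) :+ (con ½ :* (con ½ :* d) :- ε)) :* (c :* a :* b))
                  refl d ε λ′ a b c e

≟F⇒≡ : ∀ {r} {i j : Fin r} → (i ≟F j) ≡ true → i ≡ j
≟F⇒≡ {i = zero}  {zero}  _ = refl
≟F⇒≡ {i = suc i} {suc j} e = cong suc (≟F⇒≡ e)

thick-≡ : ∀ {r} {R : Graph r} (𝓕 : Template R) (λ′ : ℚ) x y → adj R (part 𝓕 x) (part 𝓕 y) ≡ true →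
  thick λ′ 𝓕 x y ≡ isThick λ′ (Cedge 𝓕 (part 𝓕 x) (part 𝓕 y)) (λ c → adj (G 𝓕 c)) x y
thick-≡ 𝓕 λ′ x y = cong (_∧ isThick λ′ (Cedge 𝓕 (part 𝓕 x) (part 𝓕 y)) (λ c → adj (G 𝓕 c)) x y)

thick-ThickOn : ∀ {r} {R : Graph r} (𝓕 : Template R) (λ′ : ℚ) {i j} {C : Fin (k 𝓕) → Bool} →
  adj R i j ≡ true → (∀ c → C c ≡ Cedge 𝓕 i j c) →
  ThickOn λ′ C (λ c → adj (G 𝓕 c)) (thick λ′ 𝓕) (Vpart 𝓕 i) (Vpart 𝓕 j)
thick-ThickOn {R = R} 𝓕 λ′ {i} {j} {C} ij C≗Cᵢⱼ = thickOn λ {x} {y} x∈Vᵢ y∈Vⱼ →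
  let px≡i = ≟F⇒≡ x∈Vᵢ
      py≡j = ≟F⇒≡ y∈Vⱼ
  in trans (thick-≡ 𝓕 λ′ x y (subst₂ (λ p q → adj R p q ≡ true) (sym px≡i) (sym py≡j) ij))
           (isThick-cong λ′ (λ c → adj (G 𝓕 c)) x y
                         (λ c → trans (cong₂ (λ p q → Cedge 𝓕 p q c) px≡i py≡j) (sym (C≗Cᵢⱼ c))))

thick-halfSuperregular : ∀ {r} {R : Graph r} (𝓕 : Template R) {m ε d δ λ′} →
  1 ℕ.≤ m → 0ℚ < δ → 0ℚ < ε → 0ℚ < λ′ → 0ℚ ≤ d → d ≤ 1ℚ → ε ≤ quarter d → λ′ ≤ quarter d →
  IsSemiSuperTemplate R 𝓕 m ε d δ → ∀ i j → adj R i j ≡ true →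
  IsHalfSuperregular ε (½ * d) (thick λ′ 𝓕) (Vpart 𝓕 i) (Vpart 𝓕 j)
thick-halfSuperregular {R = R} 𝓕 {ε = ε} {d} {λ′ = λ′} 1≤m 0<δ 0<ε 0<λ 0≤d d≤1 ε≤d/4 λ≤d/4
                       (sizes , pairs) i j ij =
  edges , degreeᵢ , degreeⱼ
  where
  C : Fin (k 𝓕) → Bool
  C = Cedge 𝓕 i j
  0≤λ : 0ℚ ≤ λ′
  0≤λ = <⇒≤ 0<λ
  0<|C| : 0ℚ < toℚ (count C)
  0<|C| = <-≤-trans (pos*pos 0<δ (toℚ-pos 1≤m)) (proj₁ (pairs i j ij))
  0<|V| : ∀ l → 0ℚ < toℚ (count (Vpart 𝓕 l))
  0<|V| l = <-≤-trans (toℚ-pos 1≤m) (proj₁ (sizes l))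
  semiSuper : IsSemiSuperregular ε d (λ c → adj (G 𝓕 c)) (Vpart 𝓕 i) (Vpart 𝓕 j) C
  semiSuper = proj₂ (pairs i j ij)
  thickᵢⱼ : ThickOn λ′ C (λ c → adj (G 𝓕 c)) (thick λ′ 𝓕) (Vpart 𝓕 i) (Vpart 𝓕 j)
  thickᵢⱼ = thick-ThickOn 𝓕 λ′ ij (λ _ → refl)
  thickⱼᵢ : ThickOn λ′ C (λ c → adj (G 𝓕 c)) (thick λ′ 𝓕) (Vpart 𝓕 j) (Vpart 𝓕 i)
  thickⱼᵢ = thick-ThickOn 𝓕 λ′ (trans (Graph.sym R j i) ij) (inC-sym 𝓕 i j)

  edges : ∀ A′ B′ → A′ ⊆ Vpart 𝓕 i → B′ ⊆ Vpart 𝓕 j →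
    ε * toℚ (count (Vpart 𝓕 i)) ≤ toℚ (count A′) → ε * toℚ (count (Vpart 𝓕 j)) ≤ toℚ (count B′) →
    ½ * d * toℚ (count A′) * toℚ (count B′) ≤ toℚ (eCount (thick λ′ 𝓕) A′ B′)
  edges A′ B′ A′⊆Vᵢ B′⊆Vⱼ bigA bigB =
    density-loss⇒half {d = d} 0<|C| (toℚ-nonNeg (count A′)) (toℚ-nonNeg (count B′)) ε≤d/4 λ≤d/4
      (≤-trans (regular⇒colourEdges-≥ (proj₁ semiSuper) 0<ε (≤-trans ε≤d/4 (≤-trans (quarter-≤ 0≤d) d≤1))
                                       0<|C| (0<|V| i) (0<|V| j) A′⊆Vᵢ B′⊆Vⱼ bigA bigB)
               (colourEdges-≤ 0≤λ (ThickOn-⊆ thickᵢⱼ A′⊆Vᵢ B′⊆Vⱼ)))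

  degreeᵢ : ∀ x → Vpart 𝓕 i x ≡ true →
    ½ * d * toℚ (count (Vpart 𝓕 j)) ≤ toℚ (count (λ y → Vpart 𝓕 j y ∧ thick λ′ 𝓕 x y))
  degreeᵢ x x∈Vᵢ =
    degree-loss⇒half {d = d} 0<|C| (toℚ-nonNeg (count (Vpart 𝓕 j))) 0≤d λ≤d/4
      (≤-trans (proj₁ (proj₂ semiSuper) x x∈Vᵢ) (colourDegree-≤ 0≤λ thickᵢⱼ x∈Vᵢ))

  degreeⱼ : ∀ y → Vpart 𝓕 j y ≡ true →
    ½ * d * toℚ (count (Vpart 𝓕 i)) ≤ toℚ (count (λ x → Vpart 𝓕 i x ∧ thick λ′ 𝓕 y x))
  degreeⱼ y y∈Vⱼ =
    degree-loss⇒half {d = d} 0<|C| (toℚ-nonNeg (count (Vpart 𝓕 i))) 0≤d λ≤d/4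
      (≤-trans (proj₂ (proj₂ semiSuper) y y∈Vⱼ) (colourDegree-≤ 0≤λ thickⱼᵢ y∈Vⱼ))

proposition2p11 : (r : ℕ) → 2 Data.Nat.≤ r → (d δ : ℚ) → 0ℚ < d → d ≤ 1ℚ → 0ℚ < δ → δ ≤ 1ℚ →
    ∃[ λ₀ ] (0ℚ < λ₀ × ((λ' : ℚ) → 0ℚ < λ' → λ' ≤ λ₀ →
    ∃[ ε₀ ] (0ℚ < ε₀ × ((ε : ℚ) → 0ℚ < ε → ε ≤ ε₀ →
    ∃[ m₀ ] ((m : ℕ) → 1 Data.Nat.≤ m → m₀ Data.Nat.≤ m →
      (R : Graph r) (𝓕 : Template R) → IsSemiSuperTemplate R 𝓕 m ε d δ →
      (i j : Fin r) → adj R i j ≡ true →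
      IsHalfSuperregular ε (½ * d) (thick λ' 𝓕) (Vpart 𝓕 i) (Vpart 𝓕 j))))))
proposition2p11 r _ d δ 0<d d≤1 0<δ _ =
  quarter d , 0<d/4 , λ λ′ 0<λ λ≤d/4 →
  quarter d , 0<d/4 , λ ε 0<ε ε≤d/4 →
  0 , λ m 1≤m _ R 𝓕 template i j ij →
  thick-halfSuperregular 𝓕 1≤m 0<δ 0<ε 0<λ (<⇒≤ 0<d) d≤1 ε≤d/4 λ≤d/4 template i j ij
  where
  0<d/4 : 0ℚ < quarter d
  0<d/4 = pos*pos (positive⁻¹ ½) (pos*pos (positive⁻¹ ½) 0<d)
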